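{- Let $n\ge 1$ and let $\mathfrak{T}(2n+1)$ be the set of isomorphism classes of trees of order $2n+1$, with $\tau(2n+1)=|\mathfrak{T}(2n+1)|$. If every tree of order $2n+1$ is semigraceful, then the complete multigraph $K_{2n+1}^{(2\tau(2n+1))}$ (on $2n+1$ vertices, every pair of distinct vertices joined by exactly $2\tau(2n+1)$ edges) has a decomposition into $2n+1$ copies of $\mathfrak{T}(2n+1)$, i.e. its edge multiset can be partitioned into $(2n+1)\tau(2n+1)$ subgraphs such that each tree of order $2n+1$ (up to isomorphism) is isomorphic to exactly $2n+1$ of these subgraphs.
   Context: For natural numbers $m,s,t$ define $dc_{m}(s,t)=|s-t|$ if $|s-t|\le m/2$ and $dc_m(s,t)=m-|s-t|$ if $|s-t|\ge m/2$. A tree $T$ of order $2n+1$ is \emph{semigraceful} if its vertices can be labeled bijectively with the numbers $1,\dots,2n+1$ (label $\ell$) so that the multiset of induced edge labels $dc_{2n+1}(\ell(u),\ell(v))$, over the edges $uv$ of $T$, equals $\{1,1,2,2,\dots,n,n\}$. -}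

module Defs where

open import Data.Nat using (ℕ; zero; suc; _+_; _*_; _∸_; _≤ᵇ_; _≡ᵇ_; ∣_-_∣)
open import Data.Bool using (Bool; true; false; if_then_else_; _∧_; _∨_)
open import Data.Fin using (Fin; toℕ)
open import Data.List using (List; []; _∷_; map; length; lookup; concatMap; upTo; allFin)
open import Data.List.Relation.Binary.Permutation.Propositional using (_↭_)
open import Data.Product using (Σ; ∃; _×_; _,_)
open import Relation.Binary.PropositionalEquality using (_≡_; _≢_)
open import Function.Definitions using (Bijective)

-- A (multi)graph on the vertex set Fin N, given as a list of edges.
-- An edge (a , b) joins a and b (unordered: orientation is irrelevant).
Edge : ℕ → Set
Edge N = Fin N × Fin N

Graph : ℕ → Set
Graph N = List (Edge N)

mult : ∀ {N} → Graph N → Fin N → Fin N → ℕ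
mult [] u v = 0
mult ((a , b) ∷ es) u v =
  (if ((toℕ a ≡ᵇ toℕ u) ∧ (toℕ b ≡ᵇ toℕ v)) ∨ ((toℕ a ≡ᵇ toℕ v) ∧ (toℕ b ≡ᵇ toℕ u))
   then 1 else 0) + mult es u v

data Reachable {N : ℕ} (G : Graph N) : Fin N → Fin N → Set where
  here : ∀ {u} → Reachable G u u
  step : ∀ {u v w} → 0 Data.Nat.< mult G u v → Reachable G v w → Reachable G u w

record IsTree (N : ℕ) (T : Graph N) : Set where
  field
    noLoops   : ∀ u → mult T u u ≡ 0
    connected : ∀ u v → Reachable T u v
    edgeCount : length T ≡ N ∸ 1

_≅_ : ∀ {N} → Graph N → Graph N → Set
_≅_ {N} G H = Σ (Fin N → Fin N) λ π →
  Bijective _≡_ _≡_ π × (∀ u v → mult H (π u) (π v) ≡ mult G u v)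

dc : ℕ → ℕ → ℕ → ℕ
dc m s t = if (2 * ∣ s - t ∣) ≤ᵇ m then ∣ s - t ∣ else m ∸ ∣ s - t ∣

doubled : ℕ → List ℕ
doubled n = concatMap (λ k → suc k ∷ suc k ∷ []) (upTo n)

-- T (a tree of order 2n+1 on Fin (2n+1)) is semigraceful:
-- a bijective labelling with 1..2n+1 (vertex v gets label toℕ (ℓ v) + 1)
Semigraceful : (n : ℕ) → Graph (suc (2 * n)) → Set
Semigraceful n T = Σ (Fin (suc (2 * n)) → Fin (suc (2 * n))) λ ℓ →
  Bijective _≡_ _≡_ ℓ ×
  (map (λ e → dc (suc (2 * n)) (suc (toℕ (ℓ (Data.Product.proj₁ e))))
                               (suc (toℕ (ℓ (Data.Product.proj₂ e))))) T ↭ doubled n)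

-- R is a complete list of representatives of the isomorphism classes of
-- trees of order N, each class represented exactly once; so length R = τ(N).
record IsoClassReps (N : ℕ) (R : List (Graph N)) : Set where
  field
    repsTrees : ∀ i → IsTree N (lookup R i)
    complete  : ∀ T → IsTree N T → ∃ λ i → T ≅ lookup R i
    distinct  : ∀ i j → lookup R i ≅ lookup R j → i ≡ j

-- A decomposition of K_N^(λ) into N copies of each representative in R:
-- D i j (i < |R|, j < N) is the j-th copy of the i-th tree; the edge multiset
-- union of all D i j is exactly the complete multigraph with multiplicity λ.
unionAll : ∀ {N k} → (Fin k → Fin N → Graph N) → Graph N
unionAll {N} {k} D = concatMap (λ i → concatMap (λ j → D i j) (allFin N)) (allFin k)

DecomposesInto : (N λm : ℕ) → List (Graph N) → Set
DecomposesInto N λm R = Σ (Fin (length R) → Fin N → Graph N) λ D →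
  (∀ i j → D i j ≅ lookup R i) ×
  (∀ u v → u ≢ v → mult (unionAll D) u v ≡ λm) ×
  (∀ u → mult (unionAll D) u u ≡ 0)

{-# OPTIONS --safe #-}
module Submission where

-- Label each representative T semigracefully by ℓ and take its 2n+1 rotations
-- a ↦ ℓ a + j (mod 2n+1); each is a relabelling of T, hence isomorphic to it.
-- An edge with labels x, y is moved onto a pair {u, v}, u ≠ v, by one rotation
-- for each sign with y − x ≡ ±(v − u); as 2n+1 is odd at most one sign applies,
-- and one does exactly when dc(x, y) = dc(u, v). The edge labels of T are
-- 1, 1, …, n, n, so every pair {u, v} is covered exactly twice by the rotations
-- of each T, hence 2τ(2n+1) times in total.

open import Defs
open import Algebra.Properties.CommutativeSemigroup using (interchange)
open import Data.Bool using (if_then_else_)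
open import Data.Empty using (⊥; ⊥-elim)
open import Data.Fin using (Fin; toℕ)
open import Data.Fin.Properties using (toℕ-injective; toℕ<n; toℕ-fromℕ<)
open import Data.List using (List; []; _∷_; _++_; map; length; lookup; concatMap; upTo; allFin)
open import Data.List.Membership.Propositional using (_∈_)
open import Data.List.Membership.Propositional.Properties using (∈-allFin; ∈-upTo⁺)
open import Data.List.Properties using (map-cong; map-++; map-∘; length-tabulate)
open import Data.List.Relation.Binary.Permutation.Propositional using (_↭_)
open import Data.List.Relation.Binary.Permutation.Propositional.Properties using (map⁺)
open import Data.List.Relation.Unary.All as All using (All; []; _∷_)
open import Data.List.Relation.Unary.Any using (here; there)
open import Data.List.Relation.Unary.Unique.Propositional using (Unique; _∷_)
open import Data.List.Relation.Unary.Unique.Propositional.Properties using (allFin⁺; upTo⁺)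
open import Data.Nat using (ℕ; suc; _+_; _*_; _∸_; _≤_; _<_; _≤ᵇ_; NonZero; s≤s)
open import Data.Nat.DivMod using (_%_; _mod_; %-distribˡ-+; m%n%n≡m%n; [m+n]%n≡m%n; m<n⇒m%n≡m)
open import Data.Nat.ListAction using (sum)
open import Data.Nat.ListAction.Properties using (sum-++; sum-↭)
open import Data.Nat.Properties
open import Data.Product using (_×_; _,_; proj₁; proj₂)
open import Data.Sum as Sum using (_⊎_; inj₁; inj₂; [_,_]′)
open import Function using (_∘_; id)
open import Function.Bundles using (_⇔_; mk⇔; mk⤖; Bijection; Equivalence)
open import Function.Construct.Composition using (bijective)
open import Function.Definitions using (Bijective; Injective)
open import Function.Properties.Bijection using (sym-≡)
open import Relation.Binary.Definitions using (tri<; tri≈; tri>)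
open import Relation.Binary.PropositionalEquality
open import Relation.Nullary using (Dec; yes; no; does; ¬_; _×-dec_; _⊎-dec_)
open import Relation.Nullary.Decidable using (map′; dec-true; dec-false; does-⇔)

private
  variable
    A B : Set

𝟙 : Dec A → ℕ
𝟙 a? = if does a? then 1 else 0

𝟙-yes : (a? : Dec A) → A → 𝟙 a? ≡ 1
𝟙-yes a? a = cong (λ b → if b then 1 else 0) (dec-true a? a)

𝟙-no : (a? : Dec A) → ¬ A → 𝟙 a? ≡ 0
𝟙-no a? ¬a = cong (λ b → if b then 1 else 0) (dec-false a? ¬a)

𝟙-⇔ : A ⇔ B → (a? : Dec A) (b? : Dec B) → 𝟙 a? ≡ 𝟙 b?
𝟙-⇔ A⇔B a? b? = cong (λ b → if b then 1 else 0) (does-⇔ A⇔B a? b?)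

𝟙-⊎ : (A → B → ⊥) → (a? : Dec A) (b? : Dec B) → 𝟙 (a? ⊎-dec b?) ≡ 𝟙 a? + 𝟙 b?
𝟙-⊎ disjoint (yes a) (yes b) = ⊥-elim (disjoint a b)
𝟙-⊎ disjoint (yes _) (no _)  = refl
𝟙-⊎ disjoint (no _)  _       = refl

sum-map-+ : (f g : A → ℕ) (xs : List A) →
            sum (map (λ x → f x + g x) xs) ≡ sum (map f xs) + sum (map g xs)
sum-map-+ f g []       = refl
sum-map-+ f g (x ∷ xs) =
  trans (cong (f x + g x +_) (sum-map-+ f g xs))
        (interchange +-commutativeSemigroup (f x) (g x) _ _)

sum-map-zero : (f : A → ℕ) {xs : List A} → All (λ x → f x ≡ 0) xs → sum (map f xs) ≡ 0
sum-map-zero f []             = refl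
sum-map-zero f (fx≡0 ∷ fxs≡0) = cong₂ _+_ fx≡0 (sum-map-zero f fxs≡0)

sum-map-constant : ∀ {c} (f : A → ℕ) (xs : List A) → (∀ x → f x ≡ c) →
                   sum (map f xs) ≡ length xs * c
sum-map-constant f []       f≡c = refl
sum-map-constant f (x ∷ xs) f≡c = cong₂ _+_ (f≡c x) (sum-map-constant f xs f≡c)

sum-map-comm : (f : A → B → ℕ) (xs : List A) (ys : List B) →
               sum (map (λ x → sum (map (f x) ys)) xs) ≡
               sum (map (λ y → sum (map (λ x → f x y) xs)) ys)
sum-map-comm f []       ys = sym (sum-map-zero _ (All.universal (λ _ → refl) ys))
sum-map-comm f (x ∷ xs) ys =
  trans (cong (sum (map (f x) ys) +_) (sum-map-comm f xs ys)) (sym (sum-map-+ (f x) _ ys))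

sum-map-concatMap : (f : B → ℕ) (g : A → List B) (xs : List A) →
                    sum (map f (concatMap g xs)) ≡ sum (map (λ x → sum (map f (g x))) xs)
sum-map-concatMap f g []       = refl
sum-map-concatMap f g (x ∷ xs) = begin
  sum (map f (g x ++ concatMap g xs))              ≡⟨ cong sum (map-++ f (g x) _) ⟩
  sum (map f (g x) ++ map f (concatMap g xs))      ≡⟨ sum-++ (map f (g x)) _ ⟩
  sum (map f (g x)) + sum (map f (concatMap g xs)) ≡⟨ cong (_ +_) (sum-map-concatMap f g xs) ⟩
  sum (map f (g x)) + sum (map (λ x → sum (map f (g x))) xs) ∎
  where open ≡-Reasoning

sum-map-single : (f : A → ℕ) {xs : List A} {y : A} → Unique xs → y ∈ xs →
                 (∀ x → x ≢ y → f x ≡ 0) → sum (map f xs) ≡ f y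
sum-map-single f (y∉xs ∷ _) (here refl) vanish =
  trans (cong (f _ +_) (sum-map-zero f (All.map (λ y≢x → vanish _ (y≢x ∘ sym)) y∉xs)))
        (+-identityʳ _)
sum-map-single f (x∉xs ∷ xs!) (there y∈xs) vanish =
  cong₂ _+_ (vanish _ (All.lookup x∉xs y∈xs)) (sum-map-single f xs! y∈xs vanish)

-- Vertex equality is decided through toℕ, exactly as mult tests it, so that
-- mult (e ∷ G) u v unfolds to 𝟙 (joins? e u v) + mult G u v.
infix 4 _≟ᵛ_
_≟ᵛ_ : ∀ {N} (a b : Fin N) → Dec (a ≡ b)
a ≟ᵛ b = map′ toℕ-injective (cong toℕ) (toℕ a ≟ toℕ b)

joins? : ∀ {N} (e : Edge N) (u v : Fin N) →
         Dec ((proj₁ e ≡ u × proj₂ e ≡ v) ⊎ (proj₁ e ≡ v × proj₂ e ≡ u))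
joins? (a , b) u v = (a ≟ᵛ u ×-dec b ≟ᵛ v) ⊎-dec (a ≟ᵛ v ×-dec b ≟ᵛ u)

mult≡sum-joins : ∀ {N} (G : Graph N) u v → mult G u v ≡ sum (map (λ e → 𝟙 (joins? e u v)) G)
mult≡sum-joins []      u v = refl
mult≡sum-joins (e ∷ G) u v = cong (𝟙 (joins? e u v) +_) (mult≡sum-joins G u v)

mult-concatMap : ∀ {N} (g : A → Graph N) (xs : List A) u v →
                 mult (concatMap g xs) u v ≡ sum (map (λ x → mult (g x) u v) xs)
mult-concatMap g xs u v = begin
  mult (concatMap g xs) u v
    ≡⟨ mult≡sum-joins (concatMap g xs) u v ⟩
  sum (map (λ e → 𝟙 (joins? e u v)) (concatMap g xs))
    ≡⟨ sum-map-concatMap _ g xs ⟩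
  sum (map (λ x → sum (map (λ e → 𝟙 (joins? e u v)) (g x))) xs)
    ≡⟨ cong sum (map-cong (λ x → sym (mult≡sum-joins (g x) u v)) xs) ⟩
  sum (map (λ x → mult (g x) u v) xs) ∎
  where open ≡-Reasoning

mult-unionAll-uniform : ∀ {N k c} (D : Fin k → Fin N → Graph N) {u v} →
  (∀ i → sum (map (λ j → mult (D i j) u v) (allFin N)) ≡ c) → mult (unionAll D) u v ≡ k * c
mult-unionAll-uniform {N} {k} {c} D {u} {v} rows = begin
  mult (unionAll D) u v
    ≡⟨ mult-concatMap _ (allFin k) u v ⟩
  sum (map (λ i → mult (concatMap (D i) (allFin N)) u v) (allFin k))
    ≡⟨ cong sum (map-cong (λ i → mult-concatMap (D i) (allFin N) u v) (allFin k)) ⟩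
  sum (map (λ i → sum (map (λ j → mult (D i j) u v) (allFin N))) (allFin k))
    ≡⟨ sum-map-constant _ (allFin k) rows ⟩
  length (allFin k) * c
    ≡⟨ cong (_* c) (length-tabulate {n = k} id) ⟩
  k * c ∎
  where open ≡-Reasoning

unionAll-loopless : ∀ {N k} (D : Fin k → Fin N → Graph N) →
  (∀ i j u → mult (D i j) u u ≡ 0) → ∀ u → mult (unionAll D) u u ≡ 0
unionAll-loopless {N} {k} D loopless u =
  trans (mult-unionAll-uniform D λ i →
           sum-map-zero _ (All.universal (λ j → loopless i j u) (allFin N)))
        (*-zeroʳ k)

≅-loopless : ∀ {N} {G H : Graph N} → G ≅ H → (∀ w → mult H w w ≡ 0) → ∀ u → mult G u u ≡ 0
≅-loopless (π , _ , mult-π) H-loopless u = trans (sym (mult-π u u)) (H-loopless (π u))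

relabel : ∀ {N} → (Fin N → Fin N) → Graph N → Graph N
relabel σ = map λ (a , b) → σ a , σ b

mult-relabel : ∀ {N} {σ : Fin N → Fin N} → Injective _≡_ _≡_ σ →
               ∀ G u v → mult (relabel σ G) (σ u) (σ v) ≡ mult G u v
mult-relabel σ-inj []      u v = refl
mult-relabel {σ = σ} σ-inj (e ∷ G) u v =
  cong₂ _+_ (𝟙-⇔ (mk⇔ (Sum.map both-inj both-inj) (Sum.map both-cong both-cong))
                 (joins? (σ (proj₁ e) , σ (proj₂ e)) (σ u) (σ v)) (joins? e u v))
            (mult-relabel σ-inj G u v)
  where
  both-inj : ∀ {a b c d} → σ a ≡ σ c × σ b ≡ σ d → a ≡ c × b ≡ d
  both-inj (p , q) = σ-inj p , σ-inj q
  both-cong : ∀ {a b c d} → a ≡ c × b ≡ d → σ a ≡ σ c × σ b ≡ σ d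
  both-cong (p , q) = cong σ p , cong σ q

relabel-≅ : ∀ {N} {σ : Fin N → Fin N} → Bijective _≡_ _≡_ σ → ∀ G → relabel σ G ≅ G
relabel-≅ {σ = σ} σ-bij G = σ⁻¹.to , σ⁻¹.bijective , λ u v → begin
  mult G (σ⁻¹.to u) (σ⁻¹.to v)
    ≡⟨ mult-relabel (proj₁ σ-bij) G _ _ ⟨
  mult (relabel σ G) (σ (σ⁻¹.to u)) (σ (σ⁻¹.to v))
    ≡⟨ cong₂ (mult (relabel σ G)) (σ∘σ⁻¹ u) (σ∘σ⁻¹ v) ⟩
  mult (relabel σ G) u v ∎
  where
  open ≡-Reasoning
  module σ⁻¹ = Bijection (sym-≡ (mk⤖ σ-bij))
  σ∘σ⁻¹ : ∀ u → σ (σ⁻¹.to u) ≡ u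
  σ∘σ⁻¹ u = proj₂ (Bijection.strictlySurjective (mk⤖ σ-bij) u)

[m%n+k]%n≡[m+k]%n : ∀ m k n .{{_ : NonZero n}} → (m % n + k) % n ≡ (m + k) % n
[m%n+k]%n≡[m+k]%n m k n = begin
  (m % n + k) % n         ≡⟨ %-distribˡ-+ (m % n) k n ⟩
  (m % n % n + k % n) % n ≡⟨ cong (λ t → (t + k % n) % n) (m%n%n≡m%n m n) ⟩
  (m % n + k % n) % n     ≡⟨ %-distribˡ-+ m k n ⟨
  (m + k) % n             ∎
  where open ≡-Reasoning

[k+m%n]%n≡[k+m]%n : ∀ k m n .{{_ : NonZero n}} → (k + m % n) % n ≡ (k + m) % n
[k+m%n]%n≡[k+m]%n k m n = begin
  (k + m % n) % n ≡⟨ cong (_% n) (+-comm k (m % n)) ⟩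
  (m % n + k) % n ≡⟨ [m%n+k]%n≡[m+k]%n m k n ⟩
  (m + k) % n     ≡⟨ cong (_% n) (+-comm m k) ⟩
  (k + m) % n     ∎
  where open ≡-Reasoning

[[m+k]%n+l]%n≡m%n : ∀ m {k l} n .{{_ : NonZero n}} → k + l ≡ n → ((m + k) % n + l) % n ≡ m % n
[[m+k]%n+l]%n≡m%n m {k} {l} n k+l≡n = begin
  ((m + k) % n + l) % n ≡⟨ [m%n+k]%n≡[m+k]%n (m + k) l n ⟩
  (m + k + l) % n       ≡⟨ cong (_% n) (trans (+-assoc m k l) (cong (m +_) k+l≡n)) ⟩
  (m + n) % n           ≡⟨ [m+n]%n≡m%n m n ⟩
  m % n                 ∎
  where open ≡-Reasoning

module Cyclic (N : ℕ) .{{_ : NonZero N}} where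

  infixl 6 _⊕_ _⊖_

  _⊕_ : Fin N → Fin N → Fin N
  x ⊕ y = (toℕ x + toℕ y) mod N

  _⊖_ : Fin N → Fin N → Fin N
  x ⊖ y = (toℕ x + (N ∸ toℕ y)) mod N

  toℕ-⊕ : ∀ x y → toℕ (x ⊕ y) ≡ (toℕ x + toℕ y) % N
  toℕ-⊕ x y = toℕ-fromℕ< _

  toℕ-⊖ : ∀ x y → toℕ (x ⊖ y) ≡ (toℕ x + (N ∸ toℕ y)) % N
  toℕ-⊖ x y = toℕ-fromℕ< _

  toℕ-%N : ∀ x → toℕ x % N ≡ toℕ x
  toℕ-%N x = m<n⇒m%n≡m (toℕ<n x)

  ⊕-comm : ∀ x y → x ⊕ y ≡ y ⊕ x
  ⊕-comm x y = cong (_mod N) (+-comm (toℕ x) (toℕ y))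

  [x⊖y]⊕y≡x : ∀ x y → (x ⊖ y) ⊕ y ≡ x
  [x⊖y]⊕y≡x x y = toℕ-injective (begin
    toℕ ((x ⊖ y) ⊕ y)         ≡⟨ toℕ-⊕ (x ⊖ y) y ⟩
    (toℕ (x ⊖ y) + y′) % N    ≡⟨ cong (λ t → (t + y′) % N) (toℕ-⊖ x y) ⟩
    ((x′ + (N ∸ y′)) % N + y′) % N
                              ≡⟨ [[m+k]%n+l]%n≡m%n x′ N (m∸n+n≡m (<⇒≤ (toℕ<n y))) ⟩
    x′ % N                    ≡⟨ toℕ-%N x ⟩
    x′                        ∎)
    where
    open ≡-Reasoning
    x′ = toℕ x
    y′ = toℕ y

  [x⊕y]⊖y≡x : ∀ x y → (x ⊕ y) ⊖ y ≡ x
  [x⊕y]⊖y≡x x y = toℕ-injective (begin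
    toℕ ((x ⊕ y) ⊖ y)              ≡⟨ toℕ-⊖ (x ⊕ y) y ⟩
    (toℕ (x ⊕ y) + (N ∸ y′)) % N   ≡⟨ cong (λ t → (t + (N ∸ y′)) % N) (toℕ-⊕ x y) ⟩
    ((x′ + y′) % N + (N ∸ y′)) % N ≡⟨ [[m+k]%n+l]%n≡m%n x′ N (m+[n∸m]≡n (<⇒≤ (toℕ<n y))) ⟩
    x′ % N                         ≡⟨ toℕ-%N x ⟩
    x′                             ∎)
    where
    open ≡-Reasoning
    x′ = toℕ x
    y′ = toℕ y

  y⊕[u⊖x]≡[y⊖x]⊕u : ∀ x y u → y ⊕ (u ⊖ x) ≡ (y ⊖ x) ⊕ u
  y⊕[u⊖x]≡[y⊖x]⊕u x y u = toℕ-injective (begin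
    toℕ (y ⊕ (u ⊖ x))          ≡⟨ toℕ-⊕ y (u ⊖ x) ⟩
    (y′ + toℕ (u ⊖ x)) % N     ≡⟨ cong (λ t → (y′ + t) % N) (toℕ-⊖ u x) ⟩
    (y′ + (u′ + x̄) % N) % N    ≡⟨ [k+m%n]%n≡[k+m]%n y′ (u′ + x̄) N ⟩
    (y′ + (u′ + x̄)) % N        ≡⟨ cong (_% N) rearrange ⟩
    (y′ + x̄ + u′) % N          ≡⟨ [m%n+k]%n≡[m+k]%n (y′ + x̄) u′ N ⟨
    ((y′ + x̄) % N + u′) % N    ≡⟨ cong (λ t → (t + u′) % N) (toℕ-⊖ y x) ⟨
    (toℕ (y ⊖ x) + u′) % N     ≡⟨ toℕ-⊕ (y ⊖ x) u ⟨
    toℕ ((y ⊖ x) ⊕ u)          ∎)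
    where
    open ≡-Reasoning
    y′ = toℕ y
    u′ = toℕ u
    x̄ = N ∸ toℕ x
    rearrange : y′ + (u′ + x̄) ≡ y′ + x̄ + u′
    rearrange = trans (cong (y′ +_) (+-comm u′ x̄)) (sym (+-assoc y′ x̄ u′))

  ⊕≡⇔≡⊖ : ∀ {x y z} → (x ⊕ y ≡ z) ⇔ (x ≡ z ⊖ y)
  ⊕≡⇔≡⊖ {x} {y} = mk⇔ (λ { refl → sym ([x⊕y]⊖y≡x x y) }) (λ { refl → [x⊖y]⊕y≡x _ y })

  ⊕-bijective : ∀ j → Bijective _≡_ _≡_ (_⊕ j)
  ⊕-bijective j =
    (λ {x} {y} x⊕j≡y⊕j → trans (Equivalence.to ⊕≡⇔≡⊖ x⊕j≡y⊕j) ([x⊕y]⊖y≡x y j)) ,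
    (λ y → y ⊖ j , λ { refl → [x⊖y]⊕y≡x y j })

  toℕ-⊖-≥ : ∀ {x y} → toℕ y ≤ toℕ x → toℕ (x ⊖ y) ≡ toℕ x ∸ toℕ y
  toℕ-⊖-≥ {x} {y} y≤x = begin
    toℕ (x ⊖ y)          ≡⟨ toℕ-⊖ x y ⟩
    (x′ + (N ∸ y′)) % N  ≡⟨ cong (_% N) shift ⟩
    (x′ ∸ y′ + N) % N    ≡⟨ [m+n]%n≡m%n (x′ ∸ y′) N ⟩
    (x′ ∸ y′) % N        ≡⟨ m<n⇒m%n≡m (≤-<-trans (m∸n≤m x′ y′) (toℕ<n x)) ⟩
    x′ ∸ y′              ∎
    where
    open ≡-Reasoning
    x′ = toℕ x
    y′ = toℕ y
    shift : x′ + (N ∸ y′) ≡ x′ ∸ y′ + N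
    shift = begin
      x′ + (N ∸ y′)             ≡⟨ cong (_+ (N ∸ y′)) (m∸n+n≡m y≤x) ⟨
      x′ ∸ y′ + y′ + (N ∸ y′)   ≡⟨ +-assoc (x′ ∸ y′) y′ (N ∸ y′) ⟩
      x′ ∸ y′ + (y′ + (N ∸ y′)) ≡⟨ cong (x′ ∸ y′ +_) (m+[n∸m]≡n (<⇒≤ (toℕ<n y))) ⟩
      x′ ∸ y′ + N               ∎

  toℕ-⊖-< : ∀ {x y} → toℕ x < toℕ y → toℕ (x ⊖ y) + (toℕ y ∸ toℕ x) ≡ N
  toℕ-⊖-< {x} {y} x<y = begin
    toℕ (x ⊖ y) + (y′ ∸ x′)       ≡⟨ cong (_+ (y′ ∸ x′)) (trans (toℕ-⊖ x y) (m<n⇒m%n≡m below-N)) ⟩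
    x′ + (N ∸ y′) + (y′ ∸ x′)     ≡⟨ cong (_+ (y′ ∸ x′)) (+-comm x′ (N ∸ y′)) ⟩
    N ∸ y′ + x′ + (y′ ∸ x′)       ≡⟨ +-assoc (N ∸ y′) x′ (y′ ∸ x′) ⟩
    N ∸ y′ + (x′ + (y′ ∸ x′))     ≡⟨ cong (N ∸ y′ +_) (m+[n∸m]≡n (<⇒≤ x<y)) ⟩
    N ∸ y′ + y′                   ≡⟨ m∸n+n≡m (<⇒≤ (toℕ<n y)) ⟩
    N                             ∎
    where
    open ≡-Reasoning
    x′ = toℕ x
    y′ = toℕ y
    below-N : x′ + (N ∸ y′) < N
    below-N = subst (x′ + (N ∸ y′) <_) (m+[n∸m]≡n (<⇒≤ (toℕ<n y))) (+-monoˡ-< (N ∸ y′) x<y)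

  ⊖-complement : ∀ {x y} → x ≢ y → toℕ (x ⊖ y) + toℕ (y ⊖ x) ≡ N
  ⊖-complement {x} {y} x≢y with <-cmp (toℕ x) (toℕ y)
  ... | tri< x<y _ _ = trans (cong (toℕ (x ⊖ y) +_) (toℕ-⊖-≥ (<⇒≤ x<y))) (toℕ-⊖-< x<y)
  ... | tri≈ _ x≡y _ = ⊥-elim (x≢y (toℕ-injective x≡y))
  ... | tri> _ _ y<x = trans (+-comm (toℕ (x ⊖ y)) _)
                             (trans (cong (toℕ (y ⊖ x) +_) (toℕ-⊖-≥ (<⇒≤ y<x))) (toℕ-⊖-< y<x))

  rotations : (Fin N → Fin N) → Graph N → Fin N → Graph N
  rotations ℓ G j = relabel (λ a → ℓ a ⊕ j) G

  rotation-count : ∀ x y {u v} →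
    sum (map (λ j → 𝟙 (x ⊕ j ≟ᵛ u ×-dec y ⊕ j ≟ᵛ v)) (allFin N)) ≡ 𝟙 (y ⊖ x ≟ᵛ v ⊖ u)
  rotation-count x y {u} {v} = begin
    sum (map (λ j → 𝟙 (x ⊕ j ≟ᵛ u ×-dec y ⊕ j ≟ᵛ v)) (allFin N))
      ≡⟨ sum-map-single _ (allFin⁺ N) (∈-allFin (u ⊖ x)) off-orbit ⟩
    𝟙 (x ⊕ (u ⊖ x) ≟ᵛ u ×-dec y ⊕ (u ⊖ x) ≟ᵛ v)
      ≡⟨ 𝟙-⇔ (mk⇔ (λ (_ , y↦v) → Equivalence.to ⊕≡⇔≡⊖ (trans (sym exchange) y↦v))
                  (λ y⊖x≡v⊖u → x↦u , trans exchange (Equivalence.from ⊕≡⇔≡⊖ y⊖x≡v⊖u)))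
             (x ⊕ (u ⊖ x) ≟ᵛ u ×-dec y ⊕ (u ⊖ x) ≟ᵛ v) (y ⊖ x ≟ᵛ v ⊖ u) ⟩
    𝟙 (y ⊖ x ≟ᵛ v ⊖ u) ∎
    where
    open ≡-Reasoning
    exchange : y ⊕ (u ⊖ x) ≡ (y ⊖ x) ⊕ u
    exchange = y⊕[u⊖x]≡[y⊖x]⊕u x y u
    x↦u : x ⊕ (u ⊖ x) ≡ u
    x↦u = trans (⊕-comm x (u ⊖ x)) ([x⊖y]⊕y≡x u x)
    off-orbit : ∀ j → j ≢ u ⊖ x → 𝟙 (x ⊕ j ≟ᵛ u ×-dec y ⊕ j ≟ᵛ v) ≡ 0
    off-orbit j j≢u⊖x = 𝟙-no (x ⊕ j ≟ᵛ u ×-dec y ⊕ j ≟ᵛ v) λ (x⊕j≡u , _) →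
      j≢u⊖x (Equivalence.to ⊕≡⇔≡⊖ (trans (⊕-comm j x) x⊕j≡u))

  joins-rotation-count : ∀ x y {u v} → u ≢ v →
    sum (map (λ j → 𝟙 (joins? (x ⊕ j , y ⊕ j) u v)) (allFin N)) ≡
    𝟙 (y ⊖ x ≟ᵛ v ⊖ u) + 𝟙 (y ⊖ x ≟ᵛ u ⊖ v)
  joins-rotation-count x y {u} {v} u≢v = begin
    sum (map (λ j → 𝟙 (joins? (x ⊕ j , y ⊕ j) u v)) (allFin N))
      ≡⟨ cong sum (map-cong split (allFin N)) ⟩
    sum (map (λ j → 𝟙 (x ⊕ j ≟ᵛ u ×-dec y ⊕ j ≟ᵛ v) + 𝟙 (x ⊕ j ≟ᵛ v ×-dec y ⊕ j ≟ᵛ u)) (allFin N))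
      ≡⟨ sum-map-+ _ _ (allFin N) ⟩
    sum (map (λ j → 𝟙 (x ⊕ j ≟ᵛ u ×-dec y ⊕ j ≟ᵛ v)) (allFin N)) +
    sum (map (λ j → 𝟙 (x ⊕ j ≟ᵛ v ×-dec y ⊕ j ≟ᵛ u)) (allFin N))
      ≡⟨ cong₂ _+_ (rotation-count x y) (rotation-count x y) ⟩
    𝟙 (y ⊖ x ≟ᵛ v ⊖ u) + 𝟙 (y ⊖ x ≟ᵛ u ⊖ v) ∎
    where
    open ≡-Reasoning
    split : ∀ j → 𝟙 (joins? (x ⊕ j , y ⊕ j) u v) ≡
                  𝟙 (x ⊕ j ≟ᵛ u ×-dec y ⊕ j ≟ᵛ v) + 𝟙 (x ⊕ j ≟ᵛ v ×-dec y ⊕ j ≟ᵛ u)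
    split j = 𝟙-⊎ (λ (x⊕j≡u , _) (x⊕j≡v , _) → u≢v (trans (sym x⊕j≡u) x⊕j≡v))
                  (x ⊕ j ≟ᵛ u ×-dec y ⊕ j ≟ᵛ v) (x ⊕ j ≟ᵛ v ×-dec y ⊕ j ≟ᵛ u)

module OddModulus (n : ℕ) where

  N : ℕ
  N = suc (2 * n)

  open Cyclic N

  2n≡n+n : 2 * n ≡ n + n
  2n≡n+n = cong (n +_) (+-identityʳ n)

  split-at-n : ∀ {p q} → p + q ≡ N → (p ≤ n × n < q) ⊎ (n < p × q ≤ n)
  split-at-n {p} {q} p+q≡N with ≤-<-connex p n | ≤-<-connex q n
  ... | inj₁ p≤n | inj₂ n<q = inj₁ (p≤n , n<q)
  ... | inj₂ n<p | inj₁ q≤n = inj₂ (n<p , q≤n)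
  ... | inj₁ p≤n | inj₁ q≤n =
    ⊥-elim (<⇒≱ (s≤s (≤-reflexive (sym 2n≡n+n))) (subst (_≤ n + n) p+q≡N (+-mono-≤ p≤n q≤n)))
  ... | inj₂ n<p | inj₂ n<q =
    ⊥-elim (<⇒≱ (s≤s (≤-reflexive (trans (cong suc 2n≡n+n) (sym (+-suc n n)))))
                (subst (suc n + suc n ≤_) p+q≡N (+-mono-≤ n<p n<q)))

  complement-≢ : ∀ {p q} → p + q ≡ N → p ≢ q
  complement-≢ {p} p+q≡N refl with split-at-n {p} {p} p+q≡N
  ... | inj₁ (p≤n , n<p) = <⇒≱ n<p p≤n
  ... | inj₂ (n<p , p≤n) = <⇒≱ n<p p≤n

  -- dc N s t unfolds to fold ∣ s - t ∣.
  fold : ℕ → ℕ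
  fold d = if 2 * d ≤ᵇ N then d else N ∸ d

  fold-≤ : ∀ {p} → p ≤ n → fold p ≡ p
  fold-≤ {p} p≤n = cong (λ b → if b then p else N ∸ p)
    (dec-true (2 * p ≤? N) (≤-trans (*-monoʳ-≤ 2 p≤n) (n≤1+n (2 * n))))

  fold-> : ∀ {p q} → n < p → p + q ≡ N → fold p ≡ q
  fold-> {p} {q} n<p p+q≡N = begin
    fold p    ≡⟨ cong (λ b → if b then p else N ∸ p) (dec-false (2 * p ≤? N) 2p≰N) ⟩
    N ∸ p     ≡⟨ cong (_∸ p) p+q≡N ⟨
    p + q ∸ p ≡⟨ m+n∸m≡n p q ⟩
    q         ∎
    where
    open ≡-Reasoning
    2p≰N : ¬ 2 * p ≤ N
    2p≰N = <⇒≱ (≤-trans (≤-reflexive (sym (*-suc 2 n))) (*-monoʳ-≤ 2 n<p))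

  fold-complement : ∀ {p q} → p + q ≡ N → fold p ≡ fold q
  fold-complement {p} {q} p+q≡N with split-at-n {p} {q} p+q≡N
  ... | inj₁ (p≤n , n<q) = trans (fold-≤ p≤n) (sym (fold-> {q} {p} n<q (trans (+-comm q p) p+q≡N)))
  ... | inj₂ (n<p , q≤n) = trans (fold-> {p} {q} n<p p+q≡N) (sym (fold-≤ q≤n))

  fold-≡ : ∀ {p p′ q q′} → p + p′ ≡ N → q + q′ ≡ N → fold p ≡ fold q → p ≡ q ⊎ p ≡ q′
  fold-≡ {p} {p′} {q} {q′} p+p′≡N q+q′≡N fp≡fq
    with split-at-n {p} {p′} p+p′≡N | split-at-n {q} {q′} q+q′≡N
  ... | inj₁ (p≤n , _) | inj₁ (q≤n , _) =
    inj₁ (trans (sym (fold-≤ p≤n)) (trans fp≡fq (fold-≤ q≤n)))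
  ... | inj₁ (p≤n , _) | inj₂ (n<q , _) =
    inj₂ (trans (sym (fold-≤ p≤n)) (trans fp≡fq (fold-> {q} {q′} n<q q+q′≡N)))
  ... | inj₂ (n<p , _) | inj₁ (q≤n , _) =
    inj₂ (+-cancelʳ-≡ q p q′ (trans p+q≡N (trans (sym q+q′≡N) (+-comm q q′))))
    where
    p′≡q : p′ ≡ q
    p′≡q = trans (sym (fold-> {p} {p′} n<p p+p′≡N)) (trans fp≡fq (fold-≤ q≤n))
    p+q≡N : p + q ≡ N
    p+q≡N = subst (λ r → p + r ≡ N) p′≡q p+p′≡N
  ... | inj₂ (n<p , _) | inj₂ (n<q , _) =
    inj₁ (+-cancelʳ-≡ q′ p q (trans (cong (p +_) (sym p′≡q′)) (trans p+p′≡N (sym q+q′≡N))))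
    where
    p′≡q′ : p′ ≡ q′
    p′≡q′ = trans (sym (fold-> {p} {p′} n<p p+p′≡N)) (trans fp≡fq (fold-> {q} {q′} n<q q+q′≡N))

  fold-classes : ∀ {p q q′} → p ≤ N → q + q′ ≡ N →
                 𝟙 (p ≟ q) + 𝟙 (p ≟ q′) ≡ 𝟙 (fold p ≟ fold q)
  fold-classes {p} {q} {q′} p≤N q+q′≡N = begin
    𝟙 (p ≟ q) + 𝟙 (p ≟ q′)
      ≡⟨ 𝟙-⊎ (λ p≡q p≡q′ → complement-≢ q+q′≡N (trans (sym p≡q) p≡q′)) (p ≟ q) (p ≟ q′) ⟨
    𝟙 (p ≟ q ⊎-dec p ≟ q′)
      ≡⟨ 𝟙-⇔ (mk⇔ [ cong fold , fold-q′ ]′ (fold-≡ {p} {N ∸ p} (m+[n∸m]≡n p≤N) q+q′≡N))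
             (p ≟ q ⊎-dec p ≟ q′) (fold p ≟ fold q) ⟩
    𝟙 (fold p ≟ fold q) ∎
    where
    open ≡-Reasoning
    fold-q′ : p ≡ q′ → fold p ≡ fold q
    fold-q′ p≡q′ = trans (cong fold p≡q′) (sym (fold-complement {q} {q′} q+q′≡N))

  fold-range : ∀ {d} → 0 < d → d < N → 0 < fold d × fold d ≤ n
  fold-range {d} 0<d d<N with split-at-n {d} {N ∸ d} (m+[n∸m]≡n (<⇒≤ d<N))
  ... | inj₁ (d≤n , _) = subst (λ f → 0 < f × f ≤ n) (sym (fold-≤ d≤n)) (0<d , d≤n)
  ... | inj₂ (n<d , N∸d≤n) = subst (λ f → 0 < f × f ≤ n)
    (sym (fold-> {d} {N ∸ d} n<d (m+[n∸m]≡n (<⇒≤ d<N)))) (m<n⇒0<n∸m d<N , N∸d≤n)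

  dc-range : ∀ {u v : Fin N} → u ≢ v →
             0 < dc N (suc (toℕ u)) (suc (toℕ v)) × dc N (suc (toℕ u)) (suc (toℕ v)) ≤ n
  dc-range {u} {v} u≢v = fold-range
    (n≢0⇒n>0 (λ ∣u-v∣≡0 → u≢v (toℕ-injective (∣m-n∣≡0⇒m≡n ∣u-v∣≡0))))
    (≤-<-trans (∣m-n∣≤m⊔n (toℕ u) (toℕ v)) (⊔-lub (toℕ<n u) (toℕ<n v)))

  dc≡fold-⊖ : ∀ x y → dc N (suc (toℕ x)) (suc (toℕ y)) ≡ fold (toℕ (y ⊖ x))
  dc≡fold-⊖ x y with ≤-<-connex (toℕ x) (toℕ y)
  ... | inj₁ x≤y = cong fold (trans (m≤n⇒∣m-n∣≡n∸m x≤y) (sym (toℕ-⊖-≥ x≤y)))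
  ... | inj₂ y<x = trans (cong fold (m≤n⇒∣n-m∣≡n∸m (<⇒≤ y<x)))
                         (sym (fold-complement {toℕ (y ⊖ x)} {toℕ x ∸ toℕ y} (toℕ-⊖-< y<x)))

  edge-rotation-count : ∀ x y {u v} → u ≢ v →
    sum (map (λ j → 𝟙 (joins? (x ⊕ j , y ⊕ j) u v)) (allFin N)) ≡
    𝟙 (dc N (suc (toℕ x)) (suc (toℕ y)) ≟ dc N (suc (toℕ u)) (suc (toℕ v)))
  edge-rotation-count x y {u} {v} u≢v = begin
    sum (map (λ j → 𝟙 (joins? (x ⊕ j , y ⊕ j) u v)) (allFin N))
      ≡⟨ joins-rotation-count x y u≢v ⟩
    𝟙 (toℕ (y ⊖ x) ≟ toℕ (v ⊖ u)) + 𝟙 (toℕ (y ⊖ x) ≟ toℕ (u ⊖ v))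
      ≡⟨ fold-classes (<⇒≤ (toℕ<n (y ⊖ x))) (⊖-complement (u≢v ∘ sym)) ⟩
    𝟙 (fold (toℕ (y ⊖ x)) ≟ fold (toℕ (v ⊖ u)))
      ≡⟨ cong₂ (λ a b → 𝟙 (a ≟ b)) (dc≡fold-⊖ x y) (dc≡fold-⊖ u v) ⟨
    𝟙 (dc N (suc (toℕ x)) (suc (toℕ y)) ≟ dc N (suc (toℕ u)) (suc (toℕ v))) ∎
    where open ≡-Reasoning

  doubled-count : ∀ {w} → 0 < w → w ≤ n → sum (map (λ d → 𝟙 (d ≟ w)) (doubled n)) ≡ 2
  doubled-count {suc c} _ c<n = begin
    sum (map (λ d → 𝟙 (d ≟ suc c)) (doubled n))
      ≡⟨ sum-map-concatMap _ (λ k → suc k ∷ suc k ∷ []) (upTo n) ⟩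
    sum (map (λ k → twice (𝟙 (suc k ≟ suc c))) (upTo n))
      ≡⟨ sum-map-single _ (upTo⁺ n) (∈-upTo⁺ c<n) off-c ⟩
    twice (𝟙 (suc c ≟ suc c))
      ≡⟨ cong twice (𝟙-yes (suc c ≟ suc c) refl) ⟩
    2 ∎
    where
    open ≡-Reasoning
    twice : ℕ → ℕ
    twice m = m + (m + 0)
    off-c : ∀ k → k ≢ c → twice (𝟙 (suc k ≟ suc c)) ≡ 0
    off-c k k≢c = cong twice (𝟙-no (suc k ≟ suc c) (k≢c ∘ suc-injective))

  edgeLabel : (Fin N → Fin N) → Edge N → ℕ
  edgeLabel ℓ (a , b) = dc N (suc (toℕ (ℓ a))) (suc (toℕ (ℓ b)))

  rotations-cover-twice : ∀ (ℓ : Fin N → Fin N) G → map (edgeLabel ℓ) G ↭ doubled n →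
    ∀ {u v} → u ≢ v → sum (map (λ j → mult (rotations ℓ G j) u v) (allFin N)) ≡ 2
  rotations-cover-twice ℓ G labels {u} {v} u≢v = begin
    sum (map (λ j → mult (rotations ℓ G j) u v) (allFin N))
      ≡⟨ cong sum (map-cong as-edge-sum (allFin N)) ⟩
    sum (map (λ j → sum (map (λ e → 𝟙 (joins? (rotate j e) u v)) G)) (allFin N))
      ≡⟨ sum-map-comm _ (allFin N) G ⟩
    sum (map (λ e → sum (map (λ j → 𝟙 (joins? (rotate j e) u v)) (allFin N))) G)
      ≡⟨ cong sum (map-cong (λ (a , b) → edge-rotation-count (ℓ a) (ℓ b) u≢v) G) ⟩
    sum (map (λ e → 𝟙 (edgeLabel ℓ e ≟ w)) G)
      ≡⟨ cong sum (map-∘ {g = λ d → 𝟙 (d ≟ w)} {f = edgeLabel ℓ} G) ⟩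
    sum (map (λ d → 𝟙 (d ≟ w)) (map (edgeLabel ℓ) G))
      ≡⟨ sum-↭ (map⁺ _ labels) ⟩
    sum (map (λ d → 𝟙 (d ≟ w)) (doubled n))
      ≡⟨ doubled-count (proj₁ (dc-range u≢v)) (proj₂ (dc-range u≢v)) ⟩
    2 ∎
    where
    open ≡-Reasoning
    w = dc N (suc (toℕ u)) (suc (toℕ v))
    rotate : Fin N → Edge N → Edge N
    rotate j (a , b) = ℓ a ⊕ j , ℓ b ⊕ j
    as-edge-sum : ∀ j → mult (rotations ℓ G j) u v ≡ sum (map (λ e → 𝟙 (joins? (rotate j e) u v)) G)
    as-edge-sum j = trans (mult≡sum-joins (rotations ℓ G j) u v)
                          (cong sum (sym (map-∘ {g = λ e → 𝟙 (joins? e u v)} {f = rotate j} G)))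

mainTheorem3 : ∀ (n : ℕ) → 1 ≤ n →
    (∀ (T : Graph (suc (2 * n))) → IsTree (suc (2 * n)) T → Semigraceful n T) →
    ∀ (R : List (Graph (suc (2 * n)))) → IsoClassReps (suc (2 * n)) R →
    DecomposesInto (suc (2 * n)) (2 * length R) R
mainTheorem3 n _ semigraceful R reps = D , D≅R , off-diagonal , diagonal
  where
  open OddModulus n
  open Cyclic N
  open IsoClassReps reps

  labelling : ∀ i → Semigraceful n (lookup R i)
  labelling i = semigraceful (lookup R i) (repsTrees i)

  D : Fin (length R) → Fin N → Graph N
  D i = rotations (proj₁ (labelling i)) (lookup R i)

  D≅R : ∀ i j → D i j ≅ lookup R i
  D≅R i j = relabel-≅ (bijective _≡_ _≡_ _≡_ (proj₁ (proj₂ (labelling i))) (⊕-bijective j))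
                      (lookup R i)

  off-diagonal : ∀ u v → u ≢ v → mult (unionAll D) u v ≡ 2 * length R
  off-diagonal u v u≢v = trans
    (mult-unionAll-uniform D λ i →
      rotations-cover-twice (proj₁ (labelling i)) (lookup R i) (proj₂ (proj₂ (labelling i))) u≢v)
    (*-comm (length R) 2)

  diagonal : ∀ u → mult (unionAll D) u u ≡ 0
  diagonal = unionAll-loopless D λ i j →
    ≅-loopless {G = D i j} {H = lookup R i} (D≅R i j) (IsTree.noLoops (repsTrees i))
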